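{- Let $n\ge2$ be a natural number. The free group $\mathbb F_2$ on two generators is $(n,2n)$-paradoxical with respect to its natural action on itself by left multiplication, and it is not $(n,r)$-paradoxical for any $r<2n$.
   Context: For $\gamma\in\mathbb F_2$ and $E\subseteq\mathbb F_2$, $\gamma(E)=\{\gamma\beta:\beta\in E\}$. For $E,F\subseteq\mathbb F_2$ and $r\in\mathbb N$, write $E\sim_r F$ if there are a partition $E=E_0\sqcup\dots\sqcup E_{r-1}$ and elements $\gamma_0,\dots,\gamma_{r-1}\in\mathbb F_2$ with $F=\gamma_0(E_0)\sqcup\dots\sqcup\gamma_{r-1}(E_{r-1})$ (a disjoint union). A set $E$ is $(n,r)$-paradoxical if there is a partition $E=P_0\sqcup\dots\sqcup P_{n-1}$ and natural numbers $r_0,\dots,r_{n-1}$ with $P_j\sim_{r_j}E$ for all $j<n$ and $r_0+\dots+r_{n-1}=r$. -}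

module Defs where

open import Data.Bool using (Bool; true; false; not; _∧_; T; if_then_else_)
open import Data.Unit using (⊤; tt)
open import Data.List using (List; []; _∷_; foldr)
open import Data.Nat using (ℕ; zero; suc; _+_)
open import Data.Fin using (Fin; zero; suc)
open import Data.Product using (Σ; ∃; _×_; _,_)
open import Relation.Binary.PropositionalEquality using (_≡_)
open import Level using (0ℓ)
open import Relation.Unary using (Pred)

data Gen : Set where
  a b : Gen

-- A letter is a generator together with a sign (true = g, false = g⁻¹).
record Letter : Set where
  constructor _^_
  field
    gen  : Gen
    sign : Bool

sameGen : Gen → Gen → Bool
sameGen a a = true
sameGen b b = true
sameGen _ _ = false

xorB : Bool → Bool → Bool
xorB true  y = not y
xorB false y = y

cancels : Letter → Letter → Bool
cancels (g ^ s) (h ^ t) = sameGen g h ∧ xorB s t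

reduced : List Letter → Bool
reduced []              = true
reduced (x ∷ [])        = true
reduced (x ∷ y ∷ w)     = not (cancels x y) ∧ reduced (y ∷ w)

record F₂ : Set where
  constructor mk
  field
    word : List Letter
    isReduced : T (reduced word)
open F₂ public

step : Letter → List Letter → List Letter
step x []      = x ∷ []
step x (y ∷ w) = if cancels x y then w else (x ∷ y ∷ w)

private
  ⊥-elim' : {A : Set} → T false → A
  ⊥-elim' ()

  tail-red : ∀ y w → T (reduced (y ∷ w)) → T (reduced w)
  tail-red y []          p = tt
  tail-red y (z ∷ w) p with cancels y z in eq
  ... | false = p
  ... | true  = ⊥-elim' p

  ∧-intro : ∀ {u v} → T u → T v → T (u ∧ v)
  ∧-intro {true} {true} _ _ = tt

step-red : ∀ x w → T (reduced w) → T (reduced (step x w))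
step-red x []      p = tt
step-red x (y ∷ w) p with cancels x y in eq
... | true  = tail-red y w p
... | false rewrite eq = ∧-intro tt p

stepAll : List Letter → List Letter → List Letter
stepAll γ β = foldr step β γ

stepAll-red : ∀ γ β → T (reduced β) → T (reduced (stepAll γ β))
stepAll-red []      β p = p
stepAll-red (x ∷ γ) β p = step-red x (stepAll γ β) (stepAll-red γ β p)

_·_ : F₂ → F₂ → F₂
mk γ _ · mk β p = mk (stepAll γ β) (stepAll-red γ β p)

Subset : Set₁
Subset = Pred F₂ 0ℓ

_⟨_⟩ : F₂ → Subset → Subset
(γ ⟨ E ⟩) x = Σ F₂ λ β → E β × (x ≡ γ · β)

-- E = E₀ ⊔ … ⊔ E_{r-1}  (a partition / disjoint union; pieces may be empty)
IsPartition : (E : Subset) {r : ℕ} → (Fin r → Subset) → Set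
IsPartition E {r} Es =
    (∀ i x → Es i x → E x)
  × (∀ x → E x → ∃ λ i → Es i x)
  × (∀ i j x → Es i x → Es j x → i ≡ j)

_∼[_]_ : Subset → ℕ → Subset → Set₁
E ∼[ r ] F =
  Σ (Fin r → Subset) λ Es →
  Σ (Fin r → F₂) λ γs →
    IsPartition E Es × IsPartition F (λ i → γs i ⟨ Es i ⟩)

sumFin : ∀ {n} → (Fin n → ℕ) → ℕ
sumFin {zero}  f = 0
sumFin {suc n} f = f zero + sumFin (λ i → f (suc i))

Paradoxical : ℕ → ℕ → Subset → Set₁
Paradoxical n r E =
  Σ (Fin n → Subset) λ Ps →
  Σ (Fin n → ℕ) λ rs →
    IsPartition E Ps × (∀ j → Ps j ∼[ rs j ] E) × (sumFin rs ≡ r)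

Whole : Subset
Whole _ = ⊤

-- Write a reduced word as b^h r with r not starting with b^{±1}: h is its height and
-- r its branch. For j < n − 1 the j-th piece is the layer b^j (W(a) ⊔ W(a⁻¹)), W(x)
-- being the words starting with x; as a·W(a⁻¹) is the complement of W(a), the two
-- halves of a layer are translated onto a partition of F₂. The last piece is everything
-- else: it is D ⊔ b^(n−1) (∁ D) for D the words branching off at negative height, and
-- translating its second half back by b^(1−n) again partitions F₂, into D and ∁ D.
-- So n pieces with two translates each suffice. Conversely, a piece equidecomposable
-- with F₂ using a single translate is all of F₂ and leaves the other pieces empty, so
-- every piece needs two translates and r ≥ 2n.

module Submission where

open import Defs
open import Data.Nat using (ℕ; _≤_; _<_; _*_)
open import Data.Product using (_×_)
open import Relation.Nullary using (¬_)

open import Data.Bool using (true; false; not; T)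
open import Data.Bool.Properties using (T-irrelevant; not-involutive) renaming (_≟_ to _≟ᴮ_)
open import Data.Empty using (⊥-elim)
open import Data.Fin using (Fin; zero; suc; punchIn; toℕ; fromℕ; fromℕ<)
open import Data.Fin.Properties
  using (punchInᵢ≢i; toℕ-injective; toℕ-fromℕ; toℕ-fromℕ<; toℕ≤pred[n])
open import Data.Integer using (ℤ; +_; -[1+_]; 0ℤ)
import Data.Integer as ℤ
import Data.Integer.Properties as ℤ
open import Algebra.Properties.AbelianGroup ℤ.+-0-abelianGroup using (identityʳ-unique)
open import Data.List using (List; []; _∷_; _++_; _∷ʳ_; map; reverse)
open import Data.List.Properties using (≡-dec; ∷-injectiveˡ; foldr-++; unfold-reverse)
open import Data.Nat using (zero; suc; _+_; z≤n; s≤s)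
import Data.Nat as ℕ
import Data.Nat.Properties as ℕ
open import Data.Product using (∃; _,_; proj₁; proj₂)
open import Data.Sum using (_⊎_; inj₁; inj₂; [_,_]′)
open import Data.Unit using (tt)
open import Data.Vec.Functional using () renaming (_∷_ to _∷ᶠ_; [] to []ᶠ)
open import Function using (_∘_; id)
open import Relation.Binary.Definitions using (DecidableEquality)
open import Relation.Binary.PropositionalEquality
open import Relation.Nullary using (yes; no)
open import Relation.Nullary.Decidable using (map′; _×-dec_; ¬?)
open import Relation.Unary using (_≐_; _⊆_; _∪_; _∩_; ∁; Empty; Decidable; Satisfiable; Universal)
open import Relation.Unary.Properties using (≐-refl; ≐-sym)

-- Free reduction

infix 30 _⁻¹ᴸ
_⁻¹ᴸ : Letter → Letter
(g ^ s) ⁻¹ᴸ = g ^ not s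

⁻¹ᴸ-involutive : ∀ x → x ⁻¹ᴸ ⁻¹ᴸ ≡ x
⁻¹ᴸ-involutive (g ^ s) = cong (g ^_) (not-involutive s)

xorB-true : ∀ s t → xorB s t ≡ true → t ≡ not s
xorB-true true  false _ = refl
xorB-true false true  _ = refl

cancels⇒≡⁻¹ᴸ : ∀ x y → cancels x y ≡ true → y ≡ x ⁻¹ᴸ
cancels⇒≡⁻¹ᴸ (a ^ s) (a ^ t) e = cong (a ^_) (xorB-true s t e)
cancels⇒≡⁻¹ᴸ (b ^ s) (b ^ t) e = cong (b ^_) (xorB-true s t e)

cancels-⁻¹ᴸ : ∀ x → cancels (x ⁻¹ᴸ) x ≡ true
cancels-⁻¹ᴸ (a ^ true)  = refl
cancels-⁻¹ᴸ (a ^ false) = refl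
cancels-⁻¹ᴸ (b ^ true)  = refl
cancels-⁻¹ᴸ (b ^ false) = refl

_≟ᴳ_ : DecidableEquality Gen
a ≟ᴳ a = yes refl
a ≟ᴳ b = no λ ()
b ≟ᴳ a = no λ ()
b ≟ᴳ b = yes refl

_≟ᴸ_ : DecidableEquality Letter
(g ^ s) ≟ᴸ (h ^ t) =
  map′ (λ (g≡h , s≡t) → cong₂ _^_ g≡h s≡t) (λ e → cong Letter.gen e , cong Letter.sign e)
       ((g ≟ᴳ h) ×-dec (s ≟ᴮ t))

reduced-tail : ∀ x w → T (reduced (x ∷ w)) → T (reduced w)
reduced-tail x []      _ = tt
reduced-tail x (y ∷ w) p with cancels x y
... | false = p

reduced⇒¬cancels : ∀ x y w → T (reduced (x ∷ y ∷ w)) → cancels x y ≡ false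
reduced⇒¬cancels x y w p with cancels x y
... | false = refl

step-reduced : ∀ x w → T (reduced (x ∷ w)) → step x w ≡ x ∷ w
step-reduced x []      _ = refl
step-reduced x (y ∷ w) p rewrite reduced⇒¬cancels x y w p = refl

step-cancels : ∀ x y w → cancels x y ≡ true → T (reduced w) → step x (step y w) ≡ w
step-cancels x y []      x∙y _ rewrite x∙y = refl
step-cancels x y (z ∷ w) x∙y p with cancels y z in y∙z
... | false rewrite x∙y = refl
... | true = begin
  step x w   ≡⟨ step-reduced x w (subst (λ u → T (reduced (u ∷ w))) z≡x p) ⟩
  x ∷ w      ≡⟨ cong (_∷ w) (sym z≡x) ⟩
  z ∷ w      ∎
  where
  open ≡-Reasoning
  z≡x : z ≡ x
  z≡x = trans (cancels⇒≡⁻¹ᴸ y z y∙z)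
              (trans (cong _⁻¹ᴸ (cancels⇒≡⁻¹ᴸ x y x∙y)) (⁻¹ᴸ-involutive x))

stepAll-step : ∀ x w β → T (reduced w) → T (reduced β) →
               stepAll (step x w) β ≡ step x (stepAll w β)
stepAll-step x []      β _ _ = refl
stepAll-step x (y ∷ w) β p q with cancels x y in x∙y
... | false = refl
... | true  = sym (step-cancels x y (stepAll w β) x∙y (stepAll-red w β q))

stepAll-stepAll : ∀ u v β → T (reduced v) → T (reduced β) →
                  stepAll (stepAll u v) β ≡ stepAll u (stepAll v β)
stepAll-stepAll []      v β _ _ = refl
stepAll-stepAll (x ∷ u) v β p q = begin
  stepAll (step x (stepAll u v)) β   ≡⟨ stepAll-step x (stepAll u v) β (stepAll-red u v p) q ⟩
  step x (stepAll (stepAll u v) β)   ≡⟨ cong (step x) (stepAll-stepAll u v β p q) ⟩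
  step x (stepAll u (stepAll v β))   ∎
  where open ≡-Reasoning

word-injective : {x y : F₂} → word x ≡ word y → x ≡ y
word-injective {mk w p} {mk .w q} refl = cong (mk w) (T-irrelevant p q)

·-assoc : ∀ x y z → (x · y) · z ≡ x · (y · z)
·-assoc x y z =
  word-injective (stepAll-stepAll (word x) (word y) (word z) (isReduced y) (isReduced z))

inverseWord : List Letter → List Letter
inverseWord w = reverse (map _⁻¹ᴸ w)

stepAll-inverseWord : ∀ w β → T (reduced β) → stepAll (inverseWord w) (stepAll w β) ≡ β
stepAll-inverseWord []      β _ = refl
stepAll-inverseWord (x ∷ w) β p = begin
  stepAll (inverseWord (x ∷ w)) (step x (stepAll w β))
    ≡⟨ cong (λ u → stepAll u (step x (stepAll w β))) (unfold-reverse (x ⁻¹ᴸ) (map _⁻¹ᴸ w)) ⟩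
  stepAll (inverseWord w ∷ʳ x ⁻¹ᴸ) (step x (stepAll w β))
    ≡⟨ foldr-++ step _ (inverseWord w) (x ⁻¹ᴸ ∷ []) ⟩
  stepAll (inverseWord w) (step (x ⁻¹ᴸ) (step x (stepAll w β)))
    ≡⟨ cong (stepAll (inverseWord w))
            (step-cancels (x ⁻¹ᴸ) x _ (cancels-⁻¹ᴸ x) (stepAll-red w β p)) ⟩
  stepAll (inverseWord w) (stepAll w β)
    ≡⟨ stepAll-inverseWord w β p ⟩
  β ∎
  where open ≡-Reasoning

ε : F₂
ε = mk [] tt

-- The inverse word is already reduced; reducing it once more spares proving that.
infix 30 _⁻¹
_⁻¹ : F₂ → F₂
x ⁻¹ = mk (stepAll (inverseWord (word x)) []) (stepAll-red (inverseWord (word x)) [] tt)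

inverseˡ : ∀ x β → x ⁻¹ · (x · β) ≡ β
inverseˡ x β = word-injective (begin
  stepAll (stepAll u []) (stepAll (word x) (word β))
    ≡⟨ stepAll-stepAll u [] _ tt (stepAll-red (word x) (word β) (isReduced β)) ⟩
  stepAll u (stepAll (word x) (word β))
    ≡⟨ stepAll-inverseWord (word x) (word β) (isReduced β) ⟩
  word β ∎)
  where
  open ≡-Reasoning
  u = inverseWord (word x)

·-cancelˡ : ∀ γ {β β′} → γ · β ≡ γ · β′ → β ≡ β′
·-cancelˡ γ {β} {β′} e = begin
  β                  ≡⟨ sym (inverseˡ γ β) ⟩
  γ ⁻¹ · (γ · β)     ≡⟨ cong (γ ⁻¹ ·_) e ⟩
  γ ⁻¹ · (γ · β′)    ≡⟨ inverseˡ γ β′ ⟩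
  β′                 ∎
  where open ≡-Reasoning

inverseʳ : ∀ x β → x · (x ⁻¹ · β) ≡ β
inverseʳ x β = ·-cancelˡ (x ⁻¹) (inverseˡ x (x ⁻¹ · β))

-- Equidecomposability

Partition-≐ : ∀ {E E′ r} {Es Fs : Fin r → Subset} →
              E ≐ E′ → (∀ i → Es i ≐ Fs i) → IsPartition E Es → IsPartition E′ Fs
Partition-≐ (E⊆E′ , E′⊆E) Es≐Fs (sub , cover , disjoint) =
    (λ i x Fᵢx → E⊆E′ (sub i x (proj₂ (Es≐Fs i) Fᵢx)))
  , (λ x E′x → let (i , Eᵢx) = cover x (E′⊆E E′x) in i , proj₁ (Es≐Fs i) Eᵢx)
  , (λ i j x Fᵢx Fⱼx → disjoint i j x (proj₂ (Es≐Fs i) Fᵢx) (proj₂ (Es≐Fs j) Fⱼx))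

∼-respectsˡ : ∀ {E E′ F r} → E ≐ E′ → E ∼[ r ] F → E′ ∼[ r ] F
∼-respectsˡ E≐E′ (Es , γs , PE , PF) = Es , γs , Partition-≐ E≐E′ (λ _ → ≐-refl) PE , PF

Partition-pair : ∀ {E} {Ps : Fin 2 → Subset} → let P = Ps zero; Q = Ps (suc zero) in
                 P ⊆ E → Q ⊆ E → E ⊆ P ∪ Q → Empty (P ∩ Q) → IsPartition E Ps
Partition-pair {Ps = Ps} P⊆E Q⊆E E⊆P∪Q P∩Q=∅ = sub , cover , disjoint
  where
  sub : ∀ i x → Ps i x → _
  sub zero       x = P⊆E
  sub (suc zero) x = Q⊆E
  cover : ∀ x → _ → ∃ λ i → Ps i x
  cover x Ex with E⊆P∪Q Ex
  ... | inj₁ Px = zero , Px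
  ... | inj₂ Qx = suc zero , Qx
  disjoint : ∀ i j x → Ps i x → Ps j x → i ≡ j
  disjoint zero       zero       x _  _  = refl
  disjoint (suc zero) (suc zero) x _  _  = refl
  disjoint zero       (suc zero) x Px Qx = ⊥-elim (P∩Q=∅ x (Px , Qx))
  disjoint (suc zero) zero       x Qx Px = ⊥-elim (P∩Q=∅ x (Px , Qx))

⟨⟩-Partition : ∀ γ {E r} {Es : Fin r → Subset} →
               IsPartition E Es → IsPartition (γ ⟨ E ⟩) (λ i → γ ⟨ Es i ⟩)
⟨⟩-Partition γ {Es = Es} (sub , cover , disjoint) =
    (λ i x (β , Eᵢβ , x≡γβ) → β , sub i β Eᵢβ , x≡γβ)
  , (λ x (β , Eβ , x≡γβ) → let (i , Eᵢβ) = cover β Eβ in i , β , Eᵢβ , x≡γβ)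
  , (λ i j x (β , Eᵢβ , x≡γβ) (β′ , Eⱼβ′ , x≡γβ′) →
       disjoint i j β Eᵢβ (subst (Es j) (sym (·-cancelˡ γ (trans (sym x≡γβ) x≡γβ′))) Eⱼβ′))

⟨⟩-⁻¹-⟨⟩ : ∀ g γ E → (g · γ ⁻¹) ⟨ γ ⟨ E ⟩ ⟩ ≐ g ⟨ E ⟩
⟨⟩-⁻¹-⟨⟩ g γ E =
    (λ { (_ , (β , Eβ , refl) , x≡) → β , Eβ , trans x≡ (cancel β) })
  , (λ (β , Eβ , x≡gβ) → γ · β , (β , Eβ , refl) , trans x≡gβ (sym (cancel β)))
  where
  cancel : ∀ β → (g · γ ⁻¹) · (γ · β) ≡ g · β
  cancel β = trans (·-assoc g (γ ⁻¹) (γ · β)) (cong (g ·_) (inverseˡ γ β))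

⟨⟩-∼ : ∀ γ {E F r} → E ∼[ r ] F → (γ ⟨ E ⟩) ∼[ r ] F
⟨⟩-∼ γ (Es , γs , PE , PF) =
    (λ i → γ ⟨ Es i ⟩) , (λ i → γs i · γ ⁻¹)
  , ⟨⟩-Partition γ PE , Partition-≐ ≐-refl (λ i → ≐-sym (⟨⟩-⁻¹-⟨⟩ (γs i) γ (Es i))) PF

doubling : ∀ γ {X Y : Subset} → Decidable X → Empty (X ∩ Y) → γ ⟨ ∁ X ⟩ ≐ Y →
           (X ∪ Y) ∼[ 2 ] Whole
doubling γ {X} {Y} X? X∩Y=∅ (γ∁X⊆Y , Y⊆γ∁X) =
    (X ∷ᶠ Y ∷ᶠ []ᶠ) , (ε ∷ᶠ γ ⁻¹ ∷ᶠ []ᶠ)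
  , Partition-pair inj₁ inj₂ id X∩Y=∅
  , Partition-pair _ _ cover disjoint
  where
  cover : Whole ⊆ (ε ⟨ X ⟩) ∪ (γ ⁻¹ ⟨ Y ⟩)
  cover {x} _ with X? x
  ... | yes Xx = inj₁ (x , Xx , refl)
  ... | no ¬Xx = inj₂ (γ · x , γ∁X⊆Y (x , ¬Xx , refl) , sym (inverseˡ γ x))
  disjoint : Empty ((ε ⟨ X ⟩) ∩ (γ ⁻¹ ⟨ Y ⟩))
  disjoint x ((β , Xβ , refl) , (y , Yy , β≡γ⁻¹y)) with Y⊆γ∁X Yy
  ... | β′ , ¬Xβ′ , refl = ¬Xβ′ (subst X (trans β≡γ⁻¹y (inverseˡ γ β′)) Xβ)

sumFin-const : ∀ n k → sumFin {n} (λ _ → k) ≡ n * k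
sumFin-const zero    k = refl
sumFin-const (suc n) k = cong (λ s → k + s) (sumFin-const n k)

sumFin-mono : ∀ {n} {f g : Fin n → ℕ} → (∀ i → f i ≤ g i) → sumFin f ≤ sumFin g
sumFin-mono {zero}  _   = z≤n
sumFin-mono {suc n} f≤g = ℕ.+-mono-≤ (f≤g zero) (sumFin-mono (f≤g ∘ suc))

Paradoxical-fromPartition : ∀ {n k} {Ps : Fin n → Subset} →
                            IsPartition Whole Ps → (∀ j → Ps j ∼[ k ] Whole) →
                            Paradoxical n (n * k) Whole
Paradoxical-fromPartition {n} {k} {Ps} P Ps∼ = Ps , (λ _ → k) , P , Ps∼ , sumFin-const n k

-- Lower bound

¬∼[0]Whole : ∀ {E} → ¬ (E ∼[ 0 ] Whole)
¬∼[0]Whole (_ , _ , _ , (_ , cover , _)) with cover ε tt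
... | () , _

∼Whole⇒Satisfiable : ∀ {E r} → E ∼[ r ] Whole → Satisfiable E
∼Whole⇒Satisfiable (_ , _ , (sub , _ , _) , (_ , cover , _)) =
  let (i , β , Eᵢβ , _) = cover ε tt in β , sub i β Eᵢβ

∼[1]Whole⇒Universal : ∀ {E} → E ∼[ 1 ] Whole → Universal E
∼[1]Whole⇒Universal {E} (_ , γs , (sub , _ , _) , (_ , cover , _)) β with cover (γs zero · β) tt
... | zero , β′ , E₀β′ , γβ≡γβ′ = subst E (sym (·-cancelˡ (γs zero) γβ≡γβ′)) (sub zero β′ E₀β′)

-- With a second, nonempty piece around, no piece can cover F₂ by a single translate.
2≤pieces : ∀ {n} {Ps : Fin (suc (suc n)) → Subset} {rs : Fin (suc (suc n)) → ℕ} →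
           IsPartition Whole Ps → (∀ j → Ps j ∼[ rs j ] Whole) → ∀ j → 2 ≤ rs j
2≤pieces {rs = rs} (_ , _ , disjoint) Ps∼ j with rs j | Ps∼ j
... | 0           | Pⱼ∼ = ⊥-elim (¬∼[0]Whole Pⱼ∼)
... | 1           | Pⱼ∼ =
  let (β , Pβ) = ∼Whole⇒Satisfiable (Ps∼ (punchIn j zero))
  in ⊥-elim (punchInᵢ≢i j zero (disjoint _ j β Pβ (∼[1]Whole⇒Universal Pⱼ∼ β)))
... | suc (suc _) | _   = s≤s (s≤s z≤n)

Paradoxical⇒2n≤r : ∀ {n r} → 2 ≤ n → Paradoxical n r Whole → 2 * n ≤ r
Paradoxical⇒2n≤r {n} {r} (s≤s (s≤s _)) (_ , rs , P , Ps∼ , Σrs≡r) = begin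
  2 * n                   ≡⟨ ℕ.*-comm 2 n ⟩
  n * 2                   ≡⟨ sumFin-const n 2 ⟨
  sumFin {n} (λ _ → 2)    ≤⟨ sumFin-mono (2≤pieces P Ps∼) ⟩
  sumFin rs               ≡⟨ Σrs≡r ⟩
  r                       ∎
  where open ℕ.≤-Reasoning

-- Height and branch

b⁺ b⁻ a⁺ a⁻ : Letter
b⁺ = b ^ true
b⁻ = b ^ false
a⁺ = a ^ true
a⁻ = a ^ false

bʷ : ℤ → List Letter
bʷ (+ zero)           = []
bʷ (+ suc k)          = b⁺ ∷ bʷ (+ k)
bʷ -[1+ zero ]        = b⁻ ∷ []
bʷ -[1+ suc k ]       = b⁻ ∷ bʷ -[1+ k ]

data BHeadless : List Letter → Set where
  []    : BHeadless []
  aHead : ∀ s w → BHeadless ((a ^ s) ∷ w)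

step-b⁺ : ∀ z {r} → BHeadless r → step b⁺ (bʷ z ++ r) ≡ bʷ (ℤ.suc z) ++ r
step-b⁺ (+ zero)       []           = refl
step-b⁺ (+ zero)       (aHead s w)  = refl
step-b⁺ (+ suc k)      _            = refl
step-b⁺ -[1+ zero ]    _            = refl
step-b⁺ -[1+ suc k ]   _            = refl

step-b⁻ : ∀ z {r} → BHeadless r → step b⁻ (bʷ z ++ r) ≡ bʷ (ℤ.pred z) ++ r
step-b⁻ (+ zero)       []           = refl
step-b⁻ (+ zero)       (aHead s w)  = refl
step-b⁻ (+ suc k)      _            = refl
step-b⁻ -[1+ zero ]    _            = refl
step-b⁻ -[1+ suc k ]   _            = refl

stepAll-bʷ : ∀ m z {r} → BHeadless r → stepAll (bʷ (+ m)) (bʷ z ++ r) ≡ bʷ (+ m ℤ.+ z) ++ r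
stepAll-bʷ zero    z {r} _ = cong (λ i → bʷ i ++ r) (sym (ℤ.+-identityˡ z))
stepAll-bʷ (suc m) z {r} h = begin
  step b⁺ (stepAll (bʷ (+ m)) (bʷ z ++ r))   ≡⟨ cong (step b⁺) (stepAll-bʷ m z h) ⟩
  step b⁺ (bʷ (+ m ℤ.+ z) ++ r)              ≡⟨ step-b⁺ (+ m ℤ.+ z) h ⟩
  bʷ (ℤ.suc (+ m ℤ.+ z)) ++ r                ≡⟨ cong (λ i → bʷ i ++ r) (sym (ℤ.suc-+ m z)) ⟩
  bʷ (+ suc m ℤ.+ z) ++ r                    ∎
  where open ≡-Reasoning

bʷ⁺-reduced : ∀ m → T (reduced (bʷ (+ m)))
bʷ⁺-reduced zero          = tt
bʷ⁺-reduced (suc zero)    = tt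
bʷ⁺-reduced (suc (suc m)) = bʷ⁺-reduced (suc m)

bExp : List Letter → ℤ
bExp ((b ^ true)  ∷ w) = ℤ.suc (bExp w)
bExp ((b ^ false) ∷ w) = ℤ.pred (bExp w)
bExp _                 = 0ℤ

bFree : List Letter → List Letter
bFree ((b ^ _) ∷ w) = bFree w
bFree []            = []
bFree ((a ^ s) ∷ w) = a ^ s ∷ w

bFree-BHeadless : ∀ w → BHeadless (bFree w)
bFree-BHeadless []            = []
bFree-BHeadless ((a ^ s) ∷ w) = aHead s w
bFree-BHeadless ((b ^ _) ∷ w) = bFree-BHeadless w

bExp-BHeadless : ∀ {r} → BHeadless r → bExp r ≡ 0ℤ
bExp-BHeadless []          = refl
bExp-BHeadless (aHead s w) = refl

bFree-BHeadless-id : ∀ {r} → BHeadless r → bFree r ≡ r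
bFree-BHeadless-id []          = refl
bFree-BHeadless-id (aHead s w) = refl

bExp-bʷ : ∀ z {r} → BHeadless r → bExp (bʷ z ++ r) ≡ z
bExp-bʷ (+ zero)     h = bExp-BHeadless h
bExp-bʷ (+ suc k)    h = cong ℤ.suc (bExp-bʷ (+ k) h)
bExp-bʷ -[1+ zero ]  h = cong ℤ.pred (bExp-BHeadless h)
bExp-bʷ -[1+ suc k ] h = cong ℤ.pred (bExp-bʷ -[1+ k ] h)

bFree-bʷ : ∀ z {r} → BHeadless r → bFree (bʷ z ++ r) ≡ r
bFree-bʷ (+ zero)     h = bFree-BHeadless-id h
bFree-bʷ (+ suc k)    h = bFree-bʷ (+ k) h
bFree-bʷ -[1+ zero ]  h = bFree-BHeadless-id h
bFree-bʷ -[1+ suc k ] h = bFree-bʷ -[1+ k ] h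

bʷ-bExp-bFree : ∀ w → T (reduced w) → bʷ (bExp w) ++ bFree w ≡ w
bʷ-bExp-bFree []            _ = refl
bʷ-bExp-bFree ((a ^ s) ∷ w) _ = refl
bʷ-bExp-bFree ((b ^ true) ∷ w) p = begin
  bʷ (ℤ.suc (bExp w)) ++ bFree w      ≡⟨ sym (step-b⁺ (bExp w) (bFree-BHeadless w)) ⟩
  step b⁺ (bʷ (bExp w) ++ bFree w)    ≡⟨ cong (step b⁺) (bʷ-bExp-bFree w (reduced-tail b⁺ w p)) ⟩
  step b⁺ w                           ≡⟨ step-reduced b⁺ w p ⟩
  b⁺ ∷ w                              ∎
  where open ≡-Reasoning
bʷ-bExp-bFree ((b ^ false) ∷ w) p = begin
  bʷ (ℤ.pred (bExp w)) ++ bFree w     ≡⟨ sym (step-b⁻ (bExp w) (bFree-BHeadless w)) ⟩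
  step b⁻ (bʷ (bExp w) ++ bFree w)    ≡⟨ cong (step b⁻) (bʷ-bExp-bFree w (reduced-tail b⁻ w p)) ⟩
  step b⁻ w                           ≡⟨ step-reduced b⁻ w p ⟩
  b⁻ ∷ w                              ∎
  where open ≡-Reasoning

height : F₂ → ℤ
height x = bExp (word x)

branch : F₂ → List Letter
branch x = bFree (word x)

word-normalForm : ∀ x → word x ≡ bʷ (height x) ++ branch x
word-normalForm x = sym (bʷ-bExp-bFree (word x) (isReduced x))

b^ : ℕ → F₂
b^ m = mk (bʷ (+ m)) (bʷ⁺-reduced m)

b^·-normalForm : ∀ m x → word (b^ m · x) ≡ bʷ (+ m ℤ.+ height x) ++ branch x
b^·-normalForm m x = trans (cong (stepAll (bʷ (+ m))) (word-normalForm x))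
                           (stepAll-bʷ m (height x) (bFree-BHeadless (word x)))

height-b^· : ∀ m x → height (b^ m · x) ≡ + m ℤ.+ height x
height-b^· m x = trans (cong bExp (b^·-normalForm m x))
                       (bExp-bʷ (+ m ℤ.+ height x) (bFree-BHeadless (word x)))

branch-b^· : ∀ m x → branch (b^ m · x) ≡ branch x
branch-b^· m x = trans (cong bFree (b^·-normalForm m x))
                       (bFree-bʷ (+ m ℤ.+ height x) (bFree-BHeadless (word x)))

b^⁻¹·-height : ∀ m x → height x ≡ + m ℤ.+ height (b^ m ⁻¹ · x)
b^⁻¹·-height m x = trans (cong height (sym (inverseʳ (b^ m) x))) (height-b^· m (b^ m ⁻¹ · x))

b^⁻¹·-branch : ∀ m x → branch (b^ m ⁻¹ · x) ≡ branch x
b^⁻¹·-branch m x = trans (sym (branch-b^· m (b^ m ⁻¹ · x))) (cong branch (inverseʳ (b^ m) x))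

-- Ping-pong

Starts : Letter → Subset
Starts x γ = ∃ λ w → word γ ≡ x ∷ w

Starts? : ∀ x → Decidable (Starts x)
Starts? x γ with word γ
... | []    = no λ { (_ , ()) }
... | y ∷ w with y ≟ᴸ x
...   | yes refl = yes (w , refl)
...   | no  y≢x  = no λ (_ , e) → y≢x (∷-injectiveˡ e)

⟦_⟧ : Letter → F₂
⟦ x ⟧ = mk (x ∷ []) tt

step-⁻¹ᴸ-¬Starts : ∀ x w → (∀ u → w ≢ x ∷ u) → step (x ⁻¹ᴸ) w ≡ x ⁻¹ᴸ ∷ w
step-⁻¹ᴸ-¬Starts x []      _    = refl
step-⁻¹ᴸ-¬Starts x (y ∷ w) ¬x∷ with cancels (x ⁻¹ᴸ) y in e
... | false = refl
... | true  = ⊥-elim (¬x∷ w (cong (_∷ w) (trans (cancels⇒≡⁻¹ᴸ _ y e) (⁻¹ᴸ-involutive x))))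

⟦⁻¹ᴸ⟧⟨∁Starts⟩ : ∀ x → ⟦ x ⁻¹ᴸ ⟧ ⟨ ∁ (Starts x) ⟩ ≐ Starts (x ⁻¹ᴸ)
⟦⁻¹ᴸ⟧⟨∁Starts⟩ x = to , from
  where
  to : ⟦ x ⁻¹ᴸ ⟧ ⟨ ∁ (Starts x) ⟩ ⊆ Starts (x ⁻¹ᴸ)
  to (β , ¬xβ , refl) = word β , step-⁻¹ᴸ-¬Starts x (word β) (λ u e → ¬xβ (u , e))
  from : Starts (x ⁻¹ᴸ) ⊆ ⟦ x ⁻¹ᴸ ⟧ ⟨ ∁ (Starts x) ⟩
  from {mk _ p} (w , refl) =
    mk w (reduced-tail _ w p) , ¬xw , word-injective (sym (step-reduced (x ⁻¹ᴸ) w p))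
    where
    ¬xw : ¬ Starts x (mk w (reduced-tail _ w p))
    ¬xw (u , refl) with () ← trans (sym (cancels-⁻¹ᴸ x)) (reduced⇒¬cancels (x ⁻¹ᴸ) x u p)

StartsWithA : Subset
StartsWithA = Starts a⁺ ∪ Starts a⁻

StartsWithA-∼ : StartsWithA ∼[ 2 ] Whole
StartsWithA-∼ = doubling ⟦ a⁻ ⟧ (Starts? a⁺) disjoint (⟦⁻¹ᴸ⟧⟨∁Starts⟩ a⁺)
  where
  disjoint : Empty (Starts a⁺ ∩ Starts a⁻)
  disjoint _ ((_ , e) , (_ , e′)) with () ← ∷-injectiveˡ (trans (sym e) e′)

StartsWithA⇒ : ∀ {β} → StartsWithA β → height β ≡ 0ℤ × branch β ≢ []
StartsWithA⇒ (inj₁ (w , e)) rewrite e = refl , λ ()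
StartsWithA⇒ (inj₂ (w , e)) rewrite e = refl , λ ()

⇒StartsWithA : ∀ {β} → height β ≡ 0ℤ → branch β ≢ [] → StartsWithA β
⇒StartsWithA {β} h≡0 r≢[] with bFree (word β) | bFree-BHeadless (word β) | word-normalForm β
... | _ | []           | _ = ⊥-elim (r≢[] refl)
... | _ | aHead true w  | e = inj₁ (w , trans e (cong (λ z → bʷ z ++ _) h≡0))
... | _ | aHead false w | e = inj₂ (w , trans e (cong (λ z → bʷ z ++ _) h≡0))

-- The pieces

Layer : ℕ → Subset
Layer m = b^ m ⟨ StartsWithA ⟩

Layer-∼ : ∀ m → Layer m ∼[ 2 ] Whole
Layer-∼ m = ⟨⟩-∼ (b^ m) StartsWithA-∼

Layer⇒ : ∀ {m x} → Layer m x → height x ≡ + m × branch x ≢ []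
Layer⇒ {m} (β , Aβ , refl) =
  let (h≡0 , r≢[]) = StartsWithA⇒ {β} Aβ
  in trans (height-b^· m β) (trans (cong (λ h → + m ℤ.+ h) h≡0) (ℤ.+-identityʳ (+ m)))
   , r≢[] ∘ trans (sym (branch-b^· m β))

⇒Layer : ∀ {m x} → height x ≡ + m → branch x ≢ [] → Layer m x
⇒Layer {m} {x} h≡m r≢[] =
    b^ m ⁻¹ · x
  , ⇒StartsWithA {b^ m ⁻¹ · x} h≡0 (r≢[] ∘ trans (sym (b^⁻¹·-branch m x)))
  , sym (inverseʳ (b^ m) x)
  where
  h≡0 : height (b^ m ⁻¹ · x) ≡ 0ℤ
  h≡0 = identityʳ-unique (+ m) _ (trans (sym (b^⁻¹·-height m x)) h≡m)

NegativeBranch : Subset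
NegativeBranch x = branch x ≢ [] × height x ℤ.< 0ℤ

NegativeBranch? : Decidable NegativeBranch
NegativeBranch? x = ¬? (≡-dec _≟ᴸ_ (branch x) []) ×-dec (height x ℤ.<? 0ℤ)

Remainder : ℕ → Subset
Remainder N = NegativeBranch ∪ b^ N ⟨ ∁ NegativeBranch ⟩

b^⟨∁NegativeBranch⟩⇒ : ∀ {N x} → (b^ N ⟨ ∁ NegativeBranch ⟩) x →
                       branch x ≢ [] → + N ℤ.≤ height x
b^⟨∁NegativeBranch⟩⇒ {N} (β , ¬Dβ , refl) r≢[] = begin
  + N                  ≡⟨ sym (ℤ.+-identityʳ (+ N)) ⟩
  + N ℤ.+ 0ℤ           ≤⟨ ℤ.+-monoʳ-≤ (+ N) 0≤h ⟩
  + N ℤ.+ height β     ≡⟨ sym (height-b^· N β) ⟩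
  height (b^ N · β)    ∎
  where
  open ℤ.≤-Reasoning
  0≤h : 0ℤ ℤ.≤ height β
  0≤h = ℤ.≮⇒≥ λ h<0 → ¬Dβ (r≢[] ∘ trans (branch-b^· N β) , h<0)

⇒b^⟨∁NegativeBranch⟩ : ∀ {N x} → (branch x ≢ [] → + N ℤ.≤ height x) →
                       (b^ N ⟨ ∁ NegativeBranch ⟩) x
⇒b^⟨∁NegativeBranch⟩ {N} {x} N≤h = b^ N ⁻¹ · x , ¬D , sym (inverseʳ (b^ N) x)
  where
  ¬D : ¬ NegativeBranch (b^ N ⁻¹ · x)
  ¬D (r≢[] , h<0) = ℤ.≤⇒≯ (N≤h (r≢[] ∘ trans (b^⁻¹·-branch N x))) (begin-strict
    height x                           ≡⟨ b^⁻¹·-height N x ⟩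
    + N ℤ.+ height (b^ N ⁻¹ · x)       <⟨ ℤ.+-monoʳ-< (+ N) h<0 ⟩
    + N ℤ.+ 0ℤ                         ≡⟨ ℤ.+-identityʳ (+ N) ⟩
    + N                                ∎)
    where open ℤ.≤-Reasoning

Remainder-∼ : ∀ N → Remainder N ∼[ 2 ] Whole
Remainder-∼ N = doubling (b^ N) NegativeBranch? disjoint ≐-refl
  where
  disjoint : Empty (NegativeBranch ∩ b^ N ⟨ ∁ NegativeBranch ⟩)
  disjoint x ((r≢[] , h<0) , t) =
    ℤ.≤⇒≯ (ℤ.≤-trans (ℤ.+≤+ z≤n) (b^⟨∁NegativeBranch⟩⇒ {N} t r≢[])) h<0

Remainder⇒ : ∀ {N x} → Remainder N x → branch x ≢ [] → height x ℤ.< 0ℤ ⊎ + N ℤ.≤ height x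
Remainder⇒ (inj₁ (_ , h<0)) _    = inj₁ h<0
Remainder⇒ (inj₂ t)         r≢[] = inj₂ (b^⟨∁NegativeBranch⟩⇒ t r≢[])

⇒Remainder : ∀ {N x} → (branch x ≢ [] → height x ℤ.< 0ℤ ⊎ + N ℤ.≤ height x) → Remainder N x
⇒Remainder {N} {x} f with NegativeBranch? x
... | yes Dx = inj₁ Dx
... | no ¬Dx = inj₂ (⇒b^⟨∁NegativeBranch⟩ λ r≢[] →
                       [ (λ h<0 → ⊥-elim (¬Dx (r≢[] , h<0))) , id ]′ (f r≢[]))

Layer∩Remainder : ∀ {m N} → m < N → Empty (Layer m ∩ Remainder N)
Layer∩Remainder {m} {N} m<N x (L , R) with Layer⇒ {m} L
... | h≡m , r≢[] with Remainder⇒ {N} R r≢[]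
...   | inj₁ h<0 = ℤ.+≮0 (subst (ℤ._< 0ℤ) h≡m h<0)
...   | inj₂ N≤h = ℕ.<⇒≱ m<N (ℤ.drop‿+≤+ (subst (+ N ℤ.≤_) h≡m N≤h))

Layer⊎Remainder : ∀ N x → (∃ λ m → m < N × Layer m x) ⊎ Remainder N x
Layer⊎Remainder N x with ≡-dec _≟ᴸ_ (branch x) []
... | yes r≡[] = inj₂ (⇒Remainder {N} λ r≢[] → ⊥-elim (r≢[] r≡[]))
... | no r≢[] = byHeight (height x) refl
  where
  byHeight : ∀ z → height x ≡ z → (∃ λ m → m < N × Layer m x) ⊎ Remainder N x
  byHeight -[1+ _ ] h≡ = inj₂ (⇒Remainder {N} λ _ → inj₁ (subst (ℤ._< 0ℤ) (sym h≡) ℤ.-<+))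
  byHeight (+ m)    h≡ with m ℕ.<? N
  ... | yes m<N = inj₁ (m , m<N , ⇒Layer h≡ r≢[])
  ... | no  m≮N =
    inj₂ (⇒Remainder {N} λ _ → inj₂ (subst (+ N ℤ.≤_) (sym h≡) (ℤ.+≤+ (ℕ.≮⇒≥ m≮N))))

Piece : ∀ N → Fin (suc N) → Subset
Piece N j x = (toℕ j < N × Layer (toℕ j) x) ⊎ (toℕ j ≡ N × Remainder N x)

Piece-partition : ∀ N → IsPartition Whole (Piece N)
Piece-partition N = (λ _ _ _ → tt) , cover , disjoint
  where
  cover : ∀ x → Whole x → ∃ λ j → Piece N j x
  cover x _ with Layer⊎Remainder N x
  ... | inj₁ (m , m<N , L) =
    fromℕ< m<1+N , inj₁ (subst (λ k → k < N × Layer k x) (sym (toℕ-fromℕ< m<1+N)) (m<N , L))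
    where
    m<1+N = ℕ.m<n⇒m<1+n m<N
  ... | inj₂ R = fromℕ N , inj₂ (toℕ-fromℕ N , R)
  disjoint : ∀ i j x → Piece N i x → Piece N j x → i ≡ j
  disjoint i j x (inj₁ (_ , Lᵢ)) (inj₁ (_ , Lⱼ)) =
    toℕ-injective (ℤ.+-injective (trans (sym (proj₁ (Layer⇒ Lᵢ))) (proj₁ (Layer⇒ Lⱼ))))
  disjoint i j x (inj₁ (i<N , L)) (inj₂ (_ , R))  = ⊥-elim (Layer∩Remainder i<N x (L , R))
  disjoint i j x (inj₂ (_ , R))  (inj₁ (j<N , L)) = ⊥-elim (Layer∩Remainder j<N x (L , R))
  disjoint i j x (inj₂ (i≡N , _)) (inj₂ (j≡N , _)) = toℕ-injective (trans i≡N (sym j≡N))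

Piece-∼ : ∀ N j → Piece N j ∼[ 2 ] Whole
Piece-∼ N j with toℕ j ℕ.<? N
... | yes j<N = ∼-respectsˡ (Layer⊆Piece , Piece⊆Layer) (Layer-∼ (toℕ j))
  where
  Layer⊆Piece : Layer (toℕ j) ⊆ Piece N j
  Layer⊆Piece L = inj₁ (j<N , L)
  Piece⊆Layer : Piece N j ⊆ Layer (toℕ j)
  Piece⊆Layer (inj₁ (_ , L))   = L
  Piece⊆Layer (inj₂ (j≡N , _)) = ⊥-elim (ℕ.<-irrefl j≡N j<N)
... | no j≮N = ∼-respectsˡ (Remainder⊆Piece , Piece⊆Remainder) (Remainder-∼ N)
  where
  Remainder⊆Piece : Remainder N ⊆ Piece N j
  Remainder⊆Piece R = inj₂ (ℕ.≤-antisym (toℕ≤pred[n] j) (ℕ.≮⇒≥ j≮N) , R)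
  Piece⊆Remainder : Piece N j ⊆ Remainder N
  Piece⊆Remainder (inj₁ (j<N , _)) = ⊥-elim (j≮N j<N)
  Piece⊆Remainder (inj₂ (_ , R))   = R

corollary3p5 : (n : ℕ) → 2 ≤ n →
    Paradoxical n (2 * n) Whole × ((r : ℕ) → r < 2 * n → ¬ Paradoxical n r Whole)
corollary3p5 n@(suc N) 2≤n =
    subst (λ r → Paradoxical n r Whole) (ℕ.*-comm n 2)
          (Paradoxical-fromPartition (Piece-partition N) (Piece-∼ N))
  , λ r r<2n P → ℕ.<⇒≱ r<2n (Paradoxical⇒2n≤r 2≤n P)
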